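{- Let $\epsilon>0$ and let $I^1$ be the rounded instance defined in the context. If $\mathrm{OPT}(I^1)\le 1$, $\sigma^2$ is an optimal schedule of $I^1$, and $t$ is an outline of $\sigma^2$, then for every machine $i$, $\sum_{j\in\sigma^2_i}p_{ij}\le c_i$, where $p_{ij}$ and $c_i$ are those of the instance $I^2(t)$.
   Context: Robust scheduling on identical machines: $n$ jobs, $m$ identical machines, a positive integer $\Gamma$, each job $j$ has nominal processing time $\overline p_j\ge0$ and deviation $\hat p_j\ge0$. For a schedule $\sigma$ and machine $i$ with job set $\sigma_i$, $\Gamma(\sigma_i)$ denotes a set of $\Gamma$ jobs of $\sigma_i$ with largest deviation (ties arbitrary; all of $\sigma_i$ if $|\sigma_i|<\Gamma$), $C_\Gamma(\sigma_i)=\sum_{j\in\sigma_i}\overline p_j+\sum_{j\in\Gamma(\sigma_i)}\hat p_j$, $C_\Gamma(\sigma)=\max_iC_\Gamma(\sigma_i)$ and $\mathrm{OPT}$ is the minimum of $C_\Gamma$ over schedules. Rounded instance $I^1$: same jobs, machines and nominal times; its deviations are $\hat p^1_j=0$ if $\hat p_j<\epsilon/\Gamma$, and otherwise the largest value of the form $\frac{\epsilon}{\Gamma}(1+\epsilon)^r$, $r\in\mathbb{Z}_{\ge0}$, not exceeding $\hat p_j$. Let $\Delta=\{0\}\cup\{\frac{\epsilon}{\Gamma}(1+\epsilon)^r: r\in\mathbb{Z}_{\ge0},\ \frac{\epsilon}{\Gamma}(1+\epsilon)^r\le\frac1\Gamma\}$. An outline of a schedule $\sigma$ of $I^1$ with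 $C_\Gamma(\sigma)\le1$ is a vector $t\in\Delta^m$ such that: if machine $i$ has at most $\Gamma$ jobs then $t_i=0$; otherwise every job on $i$ with $\hat p^1_j>t_i$ belongs to $\Gamma(\sigma_i)$ and no job on $i$ with $\hat p^1_j<t_i$ belongs to $\Gamma(\sigma_i)$. For $t\in\Delta^m$, the instance $I^2(t)$ (unrelated machines with capacities) has the same jobs and $m$ machines, machine $i$ having capacity $c_i=1-\Gamma t_i+\epsilon$ and processing times $p_{ij}=\overline p_j+\hat p^1_j-t_i$ if $\hat p^1_j\ge t_i$ and $p_{ij}=\overline p_j$ if $\hat p^1_j<t_i$.
   Formalization: The parameter ε, the nominal processing times $\overline p_j$ and the deviations $\hat p_j$ are rational, so the rounded deviations, the outline t and the capacities $c_i$ are rational as well. -}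

module Defs where

open import Data.Nat as ℕ using (ℕ; zero; suc; NonZero)
open import Data.Integer using (+_)
open import Data.Fin using (Fin)
open import Data.Bool using (Bool; true; false; if_then_else_)
open import Data.Product using (Σ; ∃; _×_; _,_)
open import Data.Sum using (_⊎_)
open import Relation.Binary.PropositionalEquality using (_≡_)
open import Relation.Nullary using (does)
open import Data.Rational using (ℚ; 0ℚ; 1ℚ; _+_; _*_; _-_; _/_; _≤_; _<_; _⊔_; _≤?_)

pow : ℚ → ℕ → ℚ
pow q zero    = 1ℚ
pow q (suc r) = q * pow q r

ℕtoℚ : ℕ → ℚ
ℕtoℚ k = + k / 1

sumFin : (n : ℕ) → (Fin n → ℚ) → ℚ
sumFin zero    f = 0ℚ
sumFin (suc n) f = f Fin.zero + sumFin n (λ j → f (Fin.suc j))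
  where import Data.Fin as Fin

sumWhere : (n : ℕ) → (Fin n → Bool) → (Fin n → ℚ) → ℚ
sumWhere n P f = sumFin n (λ j → if P j then f j else 0ℚ)

countWhere : (n : ℕ) → (Fin n → Bool) → ℕ
countWhere zero    P = zero
countWhere (suc n) P = (if P Fin.zero then 1 else 0) ℕ.+ countWhere n (λ j → P (Fin.suc j))
  where import Data.Fin as Fin

-- max_{i : Fin m} f i  (0 for m = 0; loads are nonnegative)
maxFin : (m : ℕ) → (Fin m → ℚ) → ℚ
maxFin zero    f = 0ℚ
maxFin (suc m) f = f Fin.zero ⊔ maxFin m (λ i → f (Fin.suc i))
  where import Data.Fin as Fin

-- Schedules.  A schedule σ assigns each job j : Fin n to a machine σ j : Fin m.
-- σ_i = { j | σ j ≡ i }.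

onMachine : {n m : ℕ} → (Fin n → Fin m) → Fin m → Fin n → Bool
onMachine σ i j = does (σ j Data.Fin.≟ i)
  where import Data.Fin

-- A choice of the sets Γ(σ_i) for all machines at once, given as a Boolean
-- selection G of jobs (each job lies on exactly one machine), w.r.t. the
-- deviations dev:  on every machine i, G ∩ σ_i has min(Γ, |σ_i|) elements and
-- every selected job of σ_i has deviation ≥ every unselected job of σ_i.
IsGammaChoice : {n m : ℕ} (Γ : ℕ) (dev : Fin n → ℚ)
                (σ : Fin n → Fin m) (G : Fin n → Bool) → Set
IsGammaChoice {n} {m} Γ dev σ G =
    ((i : Fin m) →
      countWhere n (λ j → onMachine σ i j ∧ G j)
        ≡ ℕ._⊓_ Γ (countWhere n (onMachine σ i)))
  × ((j k : Fin n) → σ j ≡ σ k → G j ≡ true → G k ≡ false → dev k ≤ dev j)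
  where open import Data.Bool using (_∧_)

CΓmachine : {n m : ℕ} (nom dev : Fin n → ℚ)
            (σ : Fin n → Fin m) (G : Fin n → Bool) → Fin m → ℚ
CΓmachine {n} nom dev σ G i =
  sumWhere n (onMachine σ i) nom + sumWhere n (λ j → onMachine σ i j ∧ G j) dev
  where open import Data.Bool using (_∧_)

CΓ : {n m : ℕ} (nom dev : Fin n → ℚ)
     (σ : Fin n → Fin m) (G : Fin n → Bool) → ℚ
CΓ {n} {m} nom dev σ G = maxFin m (CΓmachine nom dev σ G)

OPT≤ : (n m Γ : ℕ) (nom dev : Fin n → ℚ) → ℚ → Set
OPT≤ n m Γ nom dev x =
  Σ (Fin n → Fin m) λ σ → Σ (Fin n → Bool) λ G →
    IsGammaChoice Γ dev σ G × (CΓ nom dev σ G ≤ x)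

IsOptimal : (n m Γ : ℕ) (nom dev : Fin n → ℚ)
            (σ : Fin n → Fin m) (G : Fin n → Bool) → Set
IsOptimal n m Γ nom dev σ G =
  IsGammaChoice Γ dev σ G ×
  ((σ' : Fin n → Fin m) (G' : Fin n → Bool) → IsGammaChoice Γ dev σ' G' →
     CΓ nom dev σ G ≤ CΓ nom dev σ' G')

εover : (ε : ℚ) (Γ : ℕ) .{{_ : NonZero Γ}} → ℚ
εover ε Γ = ε * ((+ 1) / Γ)

IsRounded : (ε : ℚ) (Γ : ℕ) .{{_ : NonZero Γ}} → ℚ → ℚ → Set
IsRounded ε Γ d d¹ =
    (d < εover ε Γ × d¹ ≡ 0ℚ)
  ⊎ (εover ε Γ ≤ d ×
     Σ ℕ λ r → d¹ ≡ εover ε Γ * pow (1ℚ + ε) r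
             × εover ε Γ * pow (1ℚ + ε) r ≤ d
             × ((r' : ℕ) → εover ε Γ * pow (1ℚ + ε) r' ≤ d → r' ℕ.≤ r))

InΔ : (ε : ℚ) (Γ : ℕ) .{{_ : NonZero Γ}} → ℚ → Set
InΔ ε Γ x =
  x ≡ 0ℚ ⊎ Σ ℕ λ r → x ≡ εover ε Γ * pow (1ℚ + ε) r × x ≤ (+ 1) / Γ

IsOutline : (n m : ℕ) (ε : ℚ) (Γ : ℕ) .{{_ : NonZero Γ}} (dev¹ : Fin n → ℚ)
            (σ : Fin n → Fin m) (G : Fin n → Bool) (t : Fin m → ℚ) → Set
IsOutline n m ε Γ dev¹ σ G t =
  (i : Fin m) → InΔ ε Γ (t i) ×
    ((countWhere n (onMachine σ i) ℕ.≤ Γ → t i ≡ 0ℚ) ×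
     (Γ ℕ.< countWhere n (onMachine σ i) →
        ((j : Fin n) → σ j ≡ i → t i < dev¹ j → G j ≡ true) ×
        ((j : Fin n) → σ j ≡ i → dev¹ j < t i → G j ≡ false)))

capacity : (ε : ℚ) (Γ : ℕ) → ℚ → ℚ
capacity ε Γ tᵢ = 1ℚ - ℕtoℚ Γ * tᵢ + ε

ptime : (nomⱼ dev¹ⱼ tᵢ : ℚ) → ℚ
ptime nomⱼ dev¹ⱼ tᵢ =
  if does (tᵢ ≤? dev¹ⱼ) then nomⱼ + dev¹ⱼ - tᵢ else nomⱼ

-- On machine i every job j satisfies p_ij + [j ∈ Γ(σ_i)]·t_i = p̄_j + [j ∈ Γ(σ_i)]·p̂¹_j,
-- because t_i separates the deviations of the jobs in Γ(σ_i) from those outside it.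
-- Summing over σ_i gives Σ_j p_ij + |Γ(σ_i)|·t_i = C_Γ(σ_i) ≤ OPT(I¹) ≤ 1, and
-- |Γ(σ_i)|·t_i = Γ·t_i since either |σ_i| > Γ, so |Γ(σ_i)| = Γ, or t_i = 0.
module Submission where

open import Defs
open import Data.Nat as ℕ using (ℕ; NonZero; _⊓_)
import Data.Nat.Properties as ℕ
import Data.Nat.Coprimality as Coprime
import Data.Integer as ℤ
import Data.Integer.Properties as ℤ
open import Data.Fin using (Fin; zero; suc; _≟_)
open import Data.Bool using (Bool; true; false; _∧_; if_then_else_)
open import Data.Product using (_×_; _,_; proj₁; proj₂)
open import Data.Sum using (inj₁; inj₂)
open import Data.Empty using (⊥; ⊥-elim)
open import Relation.Nullary using (Dec; yes; no)
open import Relation.Nullary.Decidable using (dec-true; dec-false)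
open import Relation.Binary.PropositionalEquality
open import Data.Rational
  using (ℚ; 0ℚ; 1ℚ; _≤_; _<_; _+_; _*_; _-_; -_; _≤?_; NonNegative; nonNegative)
import Data.Rational.Properties as ℚ
open import Data.Rational.Solver using (module +-*-Solver)
open +-*-Solver using (solve; _:+_; _:-_; _:=_)

ℕtoℚ-suc : (k : ℕ) → ℕtoℚ (ℕ.suc k) ≡ 1ℚ + ℕtoℚ k
-- Once ℕtoℚ k is rewritten to its normal form, 1ℚ + ℕtoℚ k computes to (1·1 + k·1) / 1.
ℕtoℚ-suc k = sym (trans
  (cong (1ℚ +_) (ℚ.normalize-coprime (Coprime.sym (Coprime.1-coprimeTo k))))
  (ℚ./-cong (cong (λ x → ℤ.+ 1 ℤ.+ x) (ℤ.*-identityʳ (ℤ.+ k))) refl))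

p+q-q≡p : (p q : ℚ) → p + q - q ≡ p
p+q-q≡p = solve 2 (λ p q → p :+ q :- q := p) refl

p-q+q≡p : (p q : ℚ) → p - q + q ≡ p
p-q+q≡p = solve 2 (λ p q → p :- q :+ q := p) refl

p+q+[r+s]≡p+r+[q+s] : (p q r s : ℚ) → p + q + (r + s) ≡ p + r + (q + s)
p+q+[r+s]≡p+r+[q+s] = solve 4 (λ p q r s → p :+ q :+ (r :+ s) := p :+ r :+ (q :+ s)) refl

p+q≤r⇒p≤r-q : {p q r : ℚ} → p + q ≤ r → p ≤ r - q
p+q≤r⇒p≤r-q {p} {q} {r} p+q≤r = subst (_≤ r - q) (p+q-q≡p p q) (ℚ.+-monoˡ-≤ (- q) p+q≤r)

p≤p+q : (p : ℚ) {q : ℚ} → 0ℚ ≤ q → p ≤ p + q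
p≤p+q p 0≤q = subst (_≤ p + _) (ℚ.+-identityʳ p) (ℚ.+-monoʳ-≤ p 0≤q)

pow-nonNeg : (q : ℚ) .{{_ : NonNegative q}} (r : ℕ) → NonNegative (pow q r)
pow-nonNeg q ℕ.zero    = _
pow-nonNeg q (ℕ.suc r) = ℚ.nonNeg*nonNeg⇒nonNeg q (pow q r) {{pow-nonNeg q r}}

rounded-nonNeg : {ε d d¹ : ℚ} {Γ : ℕ} .{{_ : NonZero Γ}} → 0ℚ ≤ ε →
                 IsRounded ε Γ d d¹ → 0ℚ ≤ d¹
rounded-nonNeg _ (inj₁ (_ , refl)) = ℚ.≤-refl
rounded-nonNeg {ε} {Γ = Γ} 0≤ε (inj₂ (_ , r , refl , _)) =
  ℚ.nonNegative⁻¹ _ {{ℚ.nonNeg*nonNeg⇒nonNeg (εover ε Γ) (pow (1ℚ + ε) r)}}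
  where
  instance
    ε-nonNeg : NonNegative ε
    ε-nonNeg = nonNegative 0≤ε
    εover-nonNeg : NonNegative (εover ε Γ)
    εover-nonNeg = ℚ.nonNeg*nonNeg⇒nonNeg ε _ {{ℚ.normalize-nonNeg 1 Γ}}
    [1+ε]^r-nonNeg : NonNegative (pow (1ℚ + ε) r)
    [1+ε]^r-nonNeg = pow-nonNeg (1ℚ + ε) {{ℚ.nonNeg+nonNeg⇒nonNeg 1ℚ ε}} r

sumFin-cong : (n : ℕ) {f g : Fin n → ℚ} → ((j : Fin n) → f j ≡ g j) →
              sumFin n f ≡ sumFin n g
sumFin-cong ℕ.zero    f≗g = refl
sumFin-cong (ℕ.suc n) f≗g = cong₂ _+_ (f≗g zero) (sumFin-cong n (λ j → f≗g (suc j)))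

sumFin-+ : (n : ℕ) (f g : Fin n → ℚ) →
           sumFin n (λ j → f j + g j) ≡ sumFin n f + sumFin n g
sumFin-+ ℕ.zero    f g = refl
sumFin-+ (ℕ.suc n) f g =
  trans (cong (f zero + g zero +_) (sumFin-+ n (λ j → f (suc j)) (λ j → g (suc j))))
        (p+q+[r+s]≡p+r+[q+s] (f zero) (g zero) _ _)

sumWhere-cong : (n : ℕ) (P : Fin n → Bool) {f g : Fin n → ℚ} →
                ((j : Fin n) → P j ≡ true → f j ≡ g j) →
                sumWhere n P f ≡ sumWhere n P g
sumWhere-cong n P f≗g = sumFin-cong n λ j → guarded (P j) (f≗g j)
  where
  guarded : {x y : ℚ} (b : Bool) → (b ≡ true → x ≡ y) →
            (if b then x else 0ℚ) ≡ (if b then y else 0ℚ)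
  guarded true  x≡y = x≡y refl
  guarded false _   = refl

sumWhere-+-∧ : (n : ℕ) (P Q : Fin n → Bool) (f g : Fin n → ℚ) →
               sumWhere n P f + sumWhere n (λ j → P j ∧ Q j) g
                 ≡ sumWhere n P (λ j → f j + (if Q j then g j else 0ℚ))
sumWhere-+-∧ n P Q f g =
  trans (sym (sumFin-+ n _ _)) (sumFin-cong n λ j → split (P j) (Q j))
  where
  split : (p q : Bool) {x y : ℚ} →
          (if p then x else 0ℚ) + (if p ∧ q then y else 0ℚ)
            ≡ (if p then x + (if q then y else 0ℚ) else 0ℚ)
  split true  q = refl
  split false q = ℚ.+-identityˡ 0ℚ

sumWhere-const : (n : ℕ) (P : Fin n → Bool) (c : ℚ) →
                 sumWhere n P (λ _ → c) ≡ ℕtoℚ (countWhere n P) * c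
sumWhere-const ℕ.zero    P c = sym (ℚ.*-zeroˡ c)
sumWhere-const (ℕ.suc n) P c with P zero
... | true  = begin
  c + sumWhere n (λ j → P (suc j)) (λ _ → c)  ≡⟨ cong (c +_) (sumWhere-const n (λ j → P (suc j)) c) ⟩
  c + ℕtoℚ k * c                              ≡⟨ cong (_+ ℕtoℚ k * c) (ℚ.*-identityˡ c) ⟨
  1ℚ * c + ℕtoℚ k * c                         ≡⟨ ℚ.*-distribʳ-+ c 1ℚ (ℕtoℚ k) ⟨
  (1ℚ + ℕtoℚ k) * c                           ≡⟨ cong (_* c) (ℕtoℚ-suc k) ⟨
  ℕtoℚ (ℕ.suc k) * c                          ∎
  where
  open ≡-Reasoning
  k : ℕ
  k = countWhere n (λ j → P (suc j))
... | false = trans (ℚ.+-identityˡ _) (sumWhere-const n (λ j → P (suc j)) c)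

countWhere-∧-≤ : (n : ℕ) (P Q : Fin n → Bool) →
                 countWhere n (λ j → P j ∧ Q j) ℕ.≤ countWhere n P
countWhere-∧-≤ ℕ.zero    P Q = ℕ.z≤n
countWhere-∧-≤ (ℕ.suc n) P Q with P zero | Q zero
... | true  | true  = ℕ.s≤s (countWhere-∧-≤ n (λ j → P (suc j)) (λ j → Q (suc j)))
... | true  | false = ℕ.m≤n⇒m≤1+n (countWhere-∧-≤ n (λ j → P (suc j)) (λ j → Q (suc j)))
... | false | _     = countWhere-∧-≤ n (λ j → P (suc j)) (λ j → Q (suc j))

countWhere-∧-< : (n : ℕ) (P Q : Fin n → Bool) (j : Fin n) → P j ≡ true → Q j ≡ false →
                 countWhere n (λ j → P j ∧ Q j) ℕ.< countWhere n P
countWhere-∧-< (ℕ.suc n) P Q zero Pj Qj rewrite Pj | Qj =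
  ℕ.s≤s (countWhere-∧-≤ n (λ j → P (suc j)) (λ j → Q (suc j)))
countWhere-∧-< (ℕ.suc n) P Q (suc j) Pj Qj =
  ℕ.+-mono-≤-< (indicator-∧-≤ (P zero) (Q zero)) (countWhere-∧-< n (λ j → P (suc j)) (λ j → Q (suc j)) j Pj Qj)
  where
  indicator-∧-≤ : (p q : Bool) → (if p ∧ q then 1 else 0) ℕ.≤ (if p then 1 else 0)
  indicator-∧-≤ true  true  = ℕ.≤-refl
  indicator-∧-≤ true  false = ℕ.z≤n
  indicator-∧-≤ false q     = ℕ.z≤n

≤-maxFin : (m : ℕ) (f : Fin m → ℚ) (i : Fin m) → f i ≤ maxFin m f
≤-maxFin (ℕ.suc m) f zero    = ℚ.p≤p⊔q (f zero) _
≤-maxFin (ℕ.suc m) f (suc i) = ℚ.≤-trans (≤-maxFin m (λ i → f (suc i)) i) (ℚ.p≤q⊔p (f zero) _)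

onMachine⇒≡ : {n m : ℕ} (σ : Fin n → Fin m) (i : Fin m) (j : Fin n) →
              onMachine σ i j ≡ true → σ j ≡ i
onMachine⇒≡ σ i j on with σ j ≟ i
... | yes σj≡i = σj≡i

ptime-≤ : (nom d t : ℚ) → t ≤ d → ptime nom d t ≡ nom + d - t
ptime-≤ nom d t t≤d = cong (λ b → if b then nom + d - t else nom) (dec-true (t ≤? d) t≤d)

ptime-≥ : (nom d t : ℚ) → d ≤ t → ptime nom d t ≡ nom
ptime-≥ nom d t d≤t = byCases (t ≤? d)
  where
  byCases : Dec (t ≤ d) → ptime nom d t ≡ nom
  byCases (yes t≤d) = begin
    ptime nom d t  ≡⟨ ptime-≤ nom d t t≤d ⟩
    nom + d - t    ≡⟨ cong (λ x → nom + x - t) (ℚ.≤-antisym d≤t t≤d) ⟩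
    nom + t - t    ≡⟨ p+q-q≡p nom t ⟩
    nom            ∎
    where open ≡-Reasoning
  byCases (no t≰d) = cong (λ b → if b then nom + d - t else nom) (dec-false (t ≤? d) t≰d)

Separates : {n m : ℕ} (dev¹ : Fin n → ℚ) (σ : Fin n → Fin m) (G : Fin n → Bool) →
            Fin m → ℚ → Set
Separates {n} dev¹ σ G i τ =
  (j : Fin n) → onMachine σ i j ≡ true →
    (G j ≡ true → τ ≤ dev¹ j) × (G j ≡ false → dev¹ j ≤ τ)

ptime-+-selected : (nom d τ : ℚ) (g : Bool) → (g ≡ true → τ ≤ d) → (g ≡ false → d ≤ τ) →
                   ptime nom d τ + (if g then τ else 0ℚ) ≡ nom + (if g then d else 0ℚ)
ptime-+-selected nom d τ true  τ≤d _ =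
  trans (cong (_+ τ) (ptime-≤ nom d τ (τ≤d refl))) (p-q+q≡p (nom + d) τ)
ptime-+-selected nom d τ false _ d≤τ = cong (_+ 0ℚ) (ptime-≥ nom d τ (d≤τ refl))

load+|Γ[σᵢ]|*τ≡CΓmachine :
  {n m : ℕ} (nom dev¹ : Fin n → ℚ) (σ : Fin n → Fin m) (G : Fin n → Bool) (i : Fin m) (τ : ℚ) →
  Separates dev¹ σ G i τ →
  sumWhere n (onMachine σ i) (λ j → ptime (nom j) (dev¹ j) τ)
    + ℕtoℚ (countWhere n (λ j → onMachine σ i j ∧ G j)) * τ
    ≡ CΓmachine nom dev¹ σ G i
load+|Γ[σᵢ]|*τ≡CΓmachine {n} nom dev¹ σ G i τ separates = begin
  sumWhere n P (λ j → ptime (nom j) (dev¹ j) τ) + ℕtoℚ (countWhere n P∧G) * τ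
    ≡⟨ cong (sumWhere n P (λ j → ptime (nom j) (dev¹ j) τ) +_) (sumWhere-const n P∧G τ) ⟨
  sumWhere n P (λ j → ptime (nom j) (dev¹ j) τ) + sumWhere n P∧G (λ _ → τ)
    ≡⟨ sumWhere-+-∧ n P G _ _ ⟩
  sumWhere n P (λ j → ptime (nom j) (dev¹ j) τ + (if G j then τ else 0ℚ))
    ≡⟨ sumWhere-cong n P (λ j on → ptime-+-selected (nom j) (dev¹ j) τ (G j)
                                     (proj₁ (separates j on)) (proj₂ (separates j on))) ⟩
  sumWhere n P (λ j → nom j + (if G j then dev¹ j else 0ℚ))
    ≡⟨ sumWhere-+-∧ n P G _ _ ⟨
  CΓmachine nom dev¹ σ G i ∎
  where
  open ≡-Reasoning
  P P∧G : Fin n → Bool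
  P = onMachine σ i
  P∧G = λ j → P j ∧ G j

module _ {n m : ℕ} {ε : ℚ} {Γ : ℕ} .{{_ : NonZero Γ}} {dev¹ : Fin n → ℚ}
         {σ : Fin n → Fin m} {G : Fin n → Bool} {t : Fin m → ℚ}
         (choice : IsGammaChoice Γ dev¹ σ G) (outline : IsOutline n m ε Γ dev¹ σ G t)
         (i : Fin m) where

  private
    P P∧G : Fin n → Bool
    P = onMachine σ i
    P∧G = λ j → P j ∧ G j

    |Γ[σᵢ]|≡Γ⊓|σᵢ| : countWhere n P∧G ≡ Γ ⊓ countWhere n P
    |Γ[σᵢ]|≡Γ⊓|σᵢ| = proj₁ choice i

  outline-separates : ((j : Fin n) → 0ℚ ≤ dev¹ j) → Separates dev¹ σ G i (t i)
  outline-separates dev¹-nonNeg with countWhere n P ℕ.≤? Γ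
  ... | yes |σᵢ|≤Γ = λ j on →
    (λ _ → subst (_≤ dev¹ j) (sym tᵢ≡0) (dev¹-nonNeg j)) ,
    (λ unselected → ⊥-elim (ℕ.<⇒≢ (countWhere-∧-< n P G j on unselected) allSelected))
    where
    tᵢ≡0 : t i ≡ 0ℚ
    tᵢ≡0 = proj₁ (proj₂ (outline i)) |σᵢ|≤Γ
    allSelected : countWhere n P∧G ≡ countWhere n P
    allSelected = trans |Γ[σᵢ]|≡Γ⊓|σᵢ| (ℕ.m≥n⇒m⊓n≡n |σᵢ|≤Γ)
  ... | no  |σᵢ|≰Γ = λ j on →
    let σⱼ≡i = onMachine⇒≡ σ i j on in
    (λ selected → ℚ.≮⇒≥ λ dⱼ<tᵢ → true≢false (trans (sym selected) (below j σⱼ≡i dⱼ<tᵢ))) ,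
    (λ unselected → ℚ.≮⇒≥ λ tᵢ<dⱼ → true≢false (trans (sym (above j σⱼ≡i tᵢ<dⱼ)) unselected))
    where
    above : (j : Fin n) → σ j ≡ i → t i < dev¹ j → G j ≡ true
    above = proj₁ (proj₂ (proj₂ (outline i)) (ℕ.≰⇒> |σᵢ|≰Γ))
    below : (j : Fin n) → σ j ≡ i → dev¹ j < t i → G j ≡ false
    below = proj₂ (proj₂ (proj₂ (outline i)) (ℕ.≰⇒> |σᵢ|≰Γ))
    true≢false : true ≡ false → ⊥
    true≢false ()

  |Γ[σᵢ]|*tᵢ≡Γ*tᵢ : ℕtoℚ (countWhere n P∧G) * t i ≡ ℕtoℚ Γ * t i
  |Γ[σᵢ]|*tᵢ≡Γ*tᵢ with countWhere n P ℕ.≤? Γ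
  ... | yes |σᵢ|≤Γ = trans (*tᵢ≡0 (ℕtoℚ (countWhere n P∧G))) (sym (*tᵢ≡0 (ℕtoℚ Γ)))
    where
    *tᵢ≡0 : (q : ℚ) → q * t i ≡ 0ℚ
    *tᵢ≡0 q = trans (cong (q *_) (proj₁ (proj₂ (outline i)) |σᵢ|≤Γ)) (ℚ.*-zeroʳ q)
  ... | no  |σᵢ|≰Γ = cong (λ k → ℕtoℚ k * t i)
                       (trans |Γ[σᵢ]|≡Γ⊓|σᵢ| (ℕ.m≤n⇒m⊓n≡m (ℕ.<⇒≤ (ℕ.≰⇒> |σᵢ|≰Γ))))

lemma3 : (n m Γ : ℕ) .{{_ : NonZero Γ}} (ε : ℚ) → 0ℚ < ε →
         (nom dev : Fin n → ℚ) →
         ((j : Fin n) → 0ℚ ≤ nom j) → ((j : Fin n) → 0ℚ ≤ dev j) →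
         (dev¹ : Fin n → ℚ) → ((j : Fin n) → IsRounded ε Γ (dev j) (dev¹ j)) →
         OPT≤ n m Γ nom dev¹ 1ℚ →
         (σ : Fin n → Fin m) (G : Fin n → Bool) →
         IsOptimal n m Γ nom dev¹ σ G →
         (t : Fin m → ℚ) → IsOutline n m ε Γ dev¹ σ G t →
         (i : Fin m) →
         sumWhere n (onMachine σ i) (λ j → ptime (nom j) (dev¹ j) (t i))
           ≤ capacity ε Γ (t i)
lemma3 n m Γ ε 0<ε nom dev _ _ dev¹ rounded (σ' , G' , choice' , CΓσ'≤1)
       σ G (choice , optimal) t outline i =
  ℚ.≤-trans (p+q≤r⇒p≤r-q load+Γtᵢ≤1) (p≤p+q (1ℚ - ℕtoℚ Γ * t i) (ℚ.<⇒≤ 0<ε))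
  where
  open ℚ.≤-Reasoning
  load : ℚ
  load = sumWhere n (onMachine σ i) (λ j → ptime (nom j) (dev¹ j) (t i))
  dev¹-nonNeg : (j : Fin n) → 0ℚ ≤ dev¹ j
  dev¹-nonNeg j = rounded-nonNeg (ℚ.<⇒≤ 0<ε) (rounded j)
  load+Γtᵢ≤1 : load + ℕtoℚ Γ * t i ≤ 1ℚ
  load+Γtᵢ≤1 = begin
    load + ℕtoℚ Γ * t i
      ≡⟨ cong (load +_) (|Γ[σᵢ]|*tᵢ≡Γ*tᵢ {ε = ε} choice outline i) ⟨
    load + ℕtoℚ (countWhere n (λ j → onMachine σ i j ∧ G j)) * t i
      ≡⟨ load+|Γ[σᵢ]|*τ≡CΓmachine nom dev¹ σ G i (t i)
           (outline-separates {ε = ε} choice outline i dev¹-nonNeg) ⟩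
    CΓmachine nom dev¹ σ G i  ≤⟨ ≤-maxFin m (CΓmachine nom dev¹ σ G) i ⟩
    CΓ nom dev¹ σ G           ≤⟨ optimal σ' G' choice' ⟩
    CΓ nom dev¹ σ' G'         ≤⟨ CΓσ'≤1 ⟩
    1ℚ                        ∎
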